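{- For every $k\in\mathbb{N}$, \[ F_{k,1}(q)=\sum_{n\ge 0}\frac{\left(q^{2k-1};q^2\right)_n\,q^{n+1}}{\left(q;q^2\right)_{n+1}}, \] where \[ F_{k,1}(q)=\sum_{n\ge 0}\frac{\left(q^{2n+2};q^2\right)_\infty\left(q^{2n+2k};q^2\right)_\infty}{\left(q^{2n+1};q^2\right)_\infty^2}\,q^{2n+1}. \]
   Context: For $n\in\mathbb{N}_0\cup\{\infty\}$, $(a;q)_n:=\prod_{j=0}^{n-1}(1-aq^j)$. Identities hold for $|q|<1$ (equivalently as formal power series in $q$). -}

module Defs where

open import Data.Nat as ℕ using (ℕ; zero; suc; _∸_)
open import Data.Integer as ℤ using (ℤ; +_; -_)
open import Data.List using (List; []; _∷_)
open import Relation.Nullary using (yes; no)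

-- Formal power series in q with integer coefficients: n ↦ coefficient of q^n.
FPS : Set
FPS = ℕ → ℤ

sumTo : ℕ → (ℕ → ℤ) → ℤ
sumTo zero    h = + 0
sumTo (suc n) h = sumTo n h ℤ.+ h n

one : FPS
one zero    = + 1
one (suc _) = + 0

mono : ℕ → FPS
mono a n with a ℕ.≟ n
... | yes _ = + 1
... | no  _ = + 0

_⊕_ : FPS → FPS → FPS
(f ⊕ g) n = f n ℤ.+ g n

_⊖_ : FPS → FPS → FPS
(f ⊖ g) n = f n ℤ.- g n

_⊛_ : FPS → FPS → FPS
(f ⊛ g) n = sumTo (suc n) (λ i → f i ℤ.* g (n ∸ i))

infixl 7 _⊛_
infixl 6 _⊕_ _⊖_

-- Multiplicative inverse of a series with constant term 1
-- (g₀ = 1, g_{N+1} = - Σ_{i=0}^{N} f_{i+1} g_{N-i}).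
-- invList f N = [g_N, g_{N-1}, …, g_0].
invList : FPS → ℕ → List ℤ
invList f zero    = + 1 ∷ []
invList f (suc N) = (- sumTo (suc N) (λ i → f (suc i) ℤ.* nth i gs)) ∷ gs
  where
    gs = invList f N
    nth : ℕ → List ℤ → ℤ
    nth _       []       = + 0
    nth zero    (x ∷ _)  = x
    nth (suc i) (_ ∷ xs) = nth i xs

inv : FPS → FPS
inv f N with invList f N
... | []    = + 0
... | x ∷ _ = x

poch : ℕ → ℕ → FPS
poch a zero    = one
poch a (suc n) = poch a n ⊛ (one ⊖ mono (a ℕ.+ 2 ℕ.* n))

-- (q^a ; q^2)_∞ as the q-adic limit: factors with j ≥ N+1 have
-- exponent a+2j > N, so coefficient N is that of the (N+1)-th partial product.
pochInf : ℕ → FPS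
pochInf a N = poch a (suc N) N

-- Σ_{n≥0} T n, for a family where T n has q-adic order > N whenever n > N
-- (true for both sums below), so coefficient N only involves n ≤ N.
sumInf : (ℕ → FPS) → FPS
sumInf T N = sumTo (suc N) (λ n → T n N)

F : ℕ → FPS
F k = sumInf (λ n →
        pochInf (2 ℕ.* n ℕ.+ 2) ⊛ pochInf (2 ℕ.* n ℕ.+ 2 ℕ.* k)
        ⊛ inv (pochInf (2 ℕ.* n ℕ.+ 1) ⊛ pochInf (2 ℕ.* n ℕ.+ 1))
        ⊛ mono (2 ℕ.* n ℕ.+ 1))

G : ℕ → FPS
G k = sumInf (λ n →
        poch (2 ℕ.* k ∸ 1) n ⊛ mono (suc n) ⊛ inv (poch 1 (suc n)))

module Submission where

-- Write c = 2k − 1 and R n = (q^(2n+2);q²)∞ / (q^(2n+1);q²)∞.  By the q-binomial theorem in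
-- base q², (q^(2n+2k);q²)∞ / (q^(2n+1);q²)∞ = Σₘ (q^c;q²)ₘ / (q²;q²)ₘ · q^((2n+1)m), so F_{k,1}
-- becomes a double sum over n and m.  Since R n = R 0 · (q;q²)ₙ / (q²;q²)ₙ, after exchanging
-- the sums the inner sum Σₙ R n q^((2m+2)n) is R 0 times another q-binomial series, namely
-- R 0 · (q^(2m+3);q²)∞ / (q^(2m+2);q²)∞ = (q²;q²)ₘ / (q;q²)ₘ₊₁, and the outer sum collapses to
-- the right-hand side.  The q-binomial theorem itself follows by iterating the functional
-- equation (1 − q^s) H(s) = (1 − q^(c+s)) H(s+2) for H(s) = Σₘ (q^c;q²)ₘ / (q²;q²)ₘ · q^(sm),
-- which holds because the difference telescopes, until H(s + 2M) ≡ 1 modulo q^(N+1).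
-- Everything is computed in ℤ[q]/(q^(N+1)) for an arbitrary N, where the infinite products
-- and sums become finite.

open import Defs
open import Algebra.Bundles using (CommutativeRing)
open import Algebra.Solver.Ring.AlmostCommutativeRing
  using (_-Raw-AlmostCommutative⟶_; fromCommutativeRing)
import Algebra.Solver.Ring as RingSolver
open import Data.Integer as ℤ using (ℤ; +_; -_; -[1+_])
import Data.Integer.Properties as ℤ
open import Data.Integer.Solver using (module +-*-Solver)
open import Data.List using (List; []; _∷_)
open import Data.Maybe using (map)
open import Data.Nat as ℕ using (ℕ; zero; suc; _∸_; _≤_; _<_; z≤n; s≤s)
import Data.Nat.Properties as ℕ
import Data.Nat.Solver as ℕ-Solver
open import Data.Product using (_,_)
open import Level using (0ℓ)
open import Relation.Binary.PropositionalEquality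
  using (_≡_; _≢_; refl; sym; trans; cong; cong₂; ≢-sym; module ≡-Reasoning)
open import Relation.Nullary using (Dec; yes; no; contradiction)
open import Relation.Nullary.Decidable using (dec⇒maybe)

-- Finite sums of integers

sumTo-cong : ∀ n {h h′ : ℕ → ℤ} → (∀ i → i < n → h i ≡ h′ i) → sumTo n h ≡ sumTo n h′
sumTo-cong zero    eq = refl
sumTo-cong (suc n) eq = cong₂ ℤ._+_ (sumTo-cong n (λ i i<n → eq i (ℕ.m<n⇒m<1+n i<n))) (eq n ℕ.≤-refl)

sumTo-zero : ∀ n {h : ℕ → ℤ} → (∀ i → i < n → h i ≡ + 0) → sumTo n h ≡ + 0
sumTo-zero zero    eq = refl
sumTo-zero (suc n) eq = cong₂ ℤ._+_ (sumTo-zero n (λ i i<n → eq i (ℕ.m<n⇒m<1+n i<n))) (eq n ℕ.≤-refl)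

sumTo-+ : ∀ n (h h′ : ℕ → ℤ) → sumTo n (λ i → h i ℤ.+ h′ i) ≡ sumTo n h ℤ.+ sumTo n h′
sumTo-+ zero    h h′ = refl
sumTo-+ (suc n) h h′ rewrite sumTo-+ n h h′ = interchange (sumTo n h) (sumTo n h′) (h n) (h′ n)
  where
  open +-*-Solver
  interchange : ∀ a b c d → a ℤ.+ b ℤ.+ (c ℤ.+ d) ≡ a ℤ.+ c ℤ.+ (b ℤ.+ d)
  interchange = solve 4 (λ a b c d → a :+ b :+ (c :+ d) := a :+ c :+ (b :+ d)) refl

sumTo-neg : ∀ n (h : ℕ → ℤ) → sumTo n (λ i → - h i) ≡ - sumTo n h
sumTo-neg zero    h = refl
sumTo-neg (suc n) h rewrite sumTo-neg n h = sym (ℤ.neg-distrib-+ (sumTo n h) (h n))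

sumTo-*ˡ : ∀ n c (h : ℕ → ℤ) → sumTo n (λ i → c ℤ.* h i) ≡ c ℤ.* sumTo n h
sumTo-*ˡ zero    c h = sym (ℤ.*-zeroʳ c)
sumTo-*ˡ (suc n) c h rewrite sumTo-*ˡ n c h = sym (ℤ.*-distribˡ-+ c (sumTo n h) (h n))

sumTo-*ʳ : ∀ n c (h : ℕ → ℤ) → sumTo n (λ i → h i ℤ.* c) ≡ sumTo n h ℤ.* c
sumTo-*ʳ zero    c h = refl
sumTo-*ʳ (suc n) c h rewrite sumTo-*ʳ n c h = sym (ℤ.*-distribʳ-+ c (sumTo n h) (h n))

sumTo-head : ∀ n (h : ℕ → ℤ) → sumTo (suc n) h ≡ h 0 ℤ.+ sumTo n (λ i → h (suc i))
sumTo-head zero    h = ℤ.+-comm (+ 0) (h 0)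
sumTo-head (suc n) h rewrite sumTo-head n h = ℤ.+-assoc (h 0) (sumTo n (λ i → h (suc i))) (h (suc n))

sumTo-reverse : ∀ n (h : ℕ → ℤ) → sumTo n h ≡ sumTo n (λ i → h (n ∸ suc i))
sumTo-reverse zero    h = refl
sumTo-reverse (suc n) h = begin
  sumTo n h ℤ.+ h n                        ≡⟨ cong (ℤ._+ h n) (sumTo-reverse n h) ⟩
  sumTo n (λ i → h (n ∸ suc i)) ℤ.+ h n    ≡⟨ ℤ.+-comm _ (h n) ⟩
  h n ℤ.+ sumTo n (λ i → h (n ∸ suc i))    ≡⟨ sumTo-head n (λ i → h (n ∸ i)) ⟨
  sumTo (suc n) (λ i → h (n ∸ i))          ∎
  where open ≡-Reasoning

sumTo-extend : ∀ {m n} (h : ℕ → ℤ) → n ≤ m → (∀ i → n ≤ i → h i ≡ + 0) → sumTo m h ≡ sumTo n h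
sumTo-extend {zero}      h z≤n   eq = refl
sumTo-extend {suc m} {n} h n≤1+m eq with n ℕ.≟ suc m
... | yes refl = refl
... | no n≢1+m = begin
  sumTo m h ℤ.+ h m  ≡⟨ cong₂ ℤ._+_ (sumTo-extend h n≤m eq) (eq m n≤m) ⟩
  sumTo n h ℤ.+ + 0  ≡⟨ ℤ.+-identityʳ _ ⟩
  sumTo n h          ∎
  where
  open ≡-Reasoning
  n≤m = ℕ.≤-pred (ℕ.≤∧≢⇒< n≤1+m n≢1+m)

sumTo-single : ∀ n a (h : ℕ → ℤ) → a < n → (∀ i → i < n → i ≢ a → h i ≡ + 0) → sumTo n h ≡ h a
sumTo-single (suc n) a h a<1+n eq with a ℕ.≟ n
... | yes refl = trans (cong (ℤ._+ h a) (sumTo-zero n (λ i i<n → eq i (ℕ.m<n⇒m<1+n i<n) (ℕ.<⇒≢ i<n))))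
                       (ℤ.+-identityˡ (h a))
... | no a≢n   = trans (cong₂ ℤ._+_ (sumTo-single n a h (ℕ.≤∧≢⇒< (ℕ.≤-pred a<1+n) a≢n)
                                                      (λ i i<n → eq i (ℕ.m<n⇒m<1+n i<n)))
                                    (eq n ℕ.≤-refl (≢-sym a≢n)))
                       (ℤ.+-identityʳ (h a))

sumTo-comm : ∀ m n (h : ℕ → ℕ → ℤ) →
             sumTo m (λ i → sumTo n (h i)) ≡ sumTo n (λ j → sumTo m (λ i → h i j))
sumTo-comm zero    n h = sym (sumTo-zero n (λ _ _ → refl))
sumTo-comm (suc m) n h rewrite sumTo-comm m n h = sym (sumTo-+ n (λ j → sumTo m (λ i → h i j)) (h m))

sumTo-triangle : ∀ n (h : ℕ → ℕ → ℤ) →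
                 sumTo n (λ i → sumTo (suc i) (λ j → h j i)) ≡ sumTo n (λ j → sumTo (n ∸ j) (λ l → h j (j ℕ.+ l)))
sumTo-triangle zero    h = refl
sumTo-triangle (suc n) h = begin
  sumTo n (λ i → sumTo (suc i) (λ j → h j i)) ℤ.+ sumTo (suc n) (λ j → h j n)
    ≡⟨ cong (ℤ._+ sumTo (suc n) (λ j → h j n)) (trans (sumTo-triangle n h) lastRowEmpty) ⟩
  sumTo (suc n) row ℤ.+ sumTo (suc n) (λ j → h j n)
    ≡⟨ sumTo-+ (suc n) row (λ j → h j n) ⟨
  sumTo (suc n) (λ j → row j ℤ.+ h j n)
    ≡⟨ sumTo-cong (suc n) (λ j j<1+n → extendRow j (ℕ.≤-pred j<1+n)) ⟩
  sumTo (suc n) (λ j → sumTo (suc n ∸ j) (λ l → h j (j ℕ.+ l)))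
    ∎
  where
  open ≡-Reasoning
  row : ℕ → ℤ
  row j = sumTo (n ∸ j) (λ l → h j (j ℕ.+ l))
  lastRowEmpty : sumTo n row ≡ sumTo (suc n) row
  lastRowEmpty rewrite ℕ.n∸n≡0 n = sym (ℤ.+-identityʳ _)
  extendRow : ∀ j → j ≤ n → row j ℤ.+ h j n ≡ sumTo (suc n ∸ j) (λ l → h j (j ℕ.+ l))
  extendRow j j≤n rewrite ℕ.+-∸-assoc 1 j≤n | ℕ.m+[n∸m]≡n j≤n = refl

sumTo-telescope : ∀ n (d : ℕ → ℤ) → sumTo n (λ i → d i ℤ.- d (suc i)) ≡ d 0 ℤ.- d n
sumTo-telescope zero    d = sym (ℤ.+-inverseʳ (d 0))
sumTo-telescope (suc n) d rewrite sumTo-telescope n d = cancel (d 0) (d n) (d (suc n))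
  where
  open +-*-Solver
  cancel : ∀ a b c → a ℤ.- b ℤ.+ (b ℤ.- c) ≡ a ℤ.- c
  cancel = solve 3 (λ a b c → a :- b :+ (b :- c) := a :- c) refl

0ₛ : FPS
0ₛ _ = + 0

-ₛ_ : FPS → FPS
(-ₛ f) n = - f n

-- Equality in ℤ[q]/(q^(N+1)).
infix 4 _≈[_]_
_≈[_]_ : FPS → ℕ → FPS → Set
f ≈[ N ] g = ∀ n → n ≤ N → f n ≡ g n

module _ {N : ℕ} where

  ⊛-comm : ∀ f g → f ⊛ g ≈[ N ] g ⊛ f
  ⊛-comm f g n _ = begin
    sumTo (suc n) (λ i → f i ℤ.* g (n ∸ i))             ≡⟨ sumTo-reverse (suc n) _ ⟩
    sumTo (suc n) (λ i → f (n ∸ i) ℤ.* g (n ∸ (n ∸ i))) ≡⟨ sumTo-cong (suc n) swap ⟩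
    sumTo (suc n) (λ i → g i ℤ.* f (n ∸ i))             ∎
    where
    open ≡-Reasoning
    swap : ∀ i → i < suc n → f (n ∸ i) ℤ.* g (n ∸ (n ∸ i)) ≡ g i ℤ.* f (n ∸ i)
    swap i i<1+n rewrite ℕ.m∸[m∸n]≡n (ℕ.≤-pred i<1+n) = ℤ.*-comm (f (n ∸ i)) (g i)

  ⊛-assoc : ∀ f g h → (f ⊛ g) ⊛ h ≈[ N ] f ⊛ (g ⊛ h)
  ⊛-assoc f g h n _ = begin
    sumTo (suc n) (λ i → sumTo (suc i) (λ j → f j ℤ.* g (i ∸ j)) ℤ.* h (n ∸ i))
      ≡⟨ sumTo-cong (suc n) (λ i _ → sym (sumTo-*ʳ (suc i) (h (n ∸ i)) _)) ⟩
    sumTo (suc n) (λ i → sumTo (suc i) (λ j → f j ℤ.* g (i ∸ j) ℤ.* h (n ∸ i)))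
      ≡⟨ sumTo-triangle (suc n) (λ j i → f j ℤ.* g (i ∸ j) ℤ.* h (n ∸ i)) ⟩
    sumTo (suc n) (λ j → sumTo (suc n ∸ j) (λ l → f j ℤ.* g (j ℕ.+ l ∸ j) ℤ.* h (n ∸ (j ℕ.+ l))))
      ≡⟨ sumTo-cong (suc n) (λ j j<1+n → row j (ℕ.≤-pred j<1+n)) ⟩
    sumTo (suc n) (λ j → f j ℤ.* sumTo (suc (n ∸ j)) (λ l → g l ℤ.* h (n ∸ j ∸ l)))
      ∎
    where
    open ≡-Reasoning
    row : ∀ j → j ≤ n → sumTo (suc n ∸ j) (λ l → f j ℤ.* g (j ℕ.+ l ∸ j) ℤ.* h (n ∸ (j ℕ.+ l)))
                      ≡ f j ℤ.* sumTo (suc (n ∸ j)) (λ l → g l ℤ.* h (n ∸ j ∸ l))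
    row j j≤n rewrite ℕ.+-∸-assoc 1 j≤n = trans
      (sumTo-cong (suc (n ∸ j)) (λ l _ → trans (ℤ.*-assoc (f j) _ _)
        (cong₂ (λ a b → f j ℤ.* (g a ℤ.* h b)) (ℕ.m+n∸m≡n j l) (sym (ℕ.∸-+-assoc n j l)))))
      (sumTo-*ˡ (suc (n ∸ j)) (f j) _)

  ⊛-distribˡ : ∀ f g h → f ⊛ (g ⊕ h) ≈[ N ] f ⊛ g ⊕ f ⊛ h
  ⊛-distribˡ f g h n _ =
    trans (sumTo-cong (suc n) (λ i _ → ℤ.*-distribˡ-+ (f i) (g (n ∸ i)) (h (n ∸ i)))) (sumTo-+ (suc n) _ _)

  ⊛-identityˡ : ∀ f → one ⊛ f ≈[ N ] f
  ⊛-identityˡ f n _ = begin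
    sumTo (suc n) (λ i → one i ℤ.* f (n ∸ i))              ≡⟨ sumTo-head n _ ⟩
    + 1 ℤ.* f n ℤ.+ sumTo n (λ i → + 0 ℤ.* f (n ∸ suc i))
      ≡⟨ cong₂ ℤ._+_ (ℤ.*-identityˡ (f n)) (sumTo-zero n (λ _ _ → refl)) ⟩
    f n ℤ.+ + 0                                            ≡⟨ ℤ.+-identityʳ (f n) ⟩
    f n                                                    ∎
    where open ≡-Reasoning

  ⊛-cong : ∀ {f f′ g g′} → f ≈[ N ] f′ → g ≈[ N ] g′ → f ⊛ g ≈[ N ] f′ ⊛ g′
  ⊛-cong f≈f′ g≈g′ n n≤N = sumTo-cong (suc n) (λ i i<1+n →
    cong₂ ℤ._*_ (f≈f′ i (ℕ.≤-trans (ℕ.≤-pred i<1+n) n≤N)) (g≈g′ (n ∸ i) (ℕ.≤-trans (ℕ.m∸n≤m n i) n≤N)))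

seriesRing : ℕ → CommutativeRing 0ℓ 0ℓ
seriesRing N = record
  { Carrier = FPS ; _≈_ = _≈[ N ]_ ; _+_ = _⊕_ ; _*_ = _⊛_ ; -_ = -ₛ_ ; 0# = 0ₛ ; 1# = one
  ; isCommutativeRing = record
    { isRing = record
      { +-isAbelianGroup = record
        { isGroup = record
          { isMonoid = record
            { isSemigroup = record
              { isMagma = record
                { isEquivalence = record
                  { refl  = λ _ _ → refl
                  ; sym   = λ p n n≤N → sym (p n n≤N)
                  ; trans = λ p q n n≤N → trans (p n n≤N) (q n n≤N) }
                ; ∙-cong = λ p q n n≤N → cong₂ ℤ._+_ (p n n≤N) (q n n≤N) }
              ; assoc = λ f g h n _ → ℤ.+-assoc (f n) (g n) (h n) }
            ; identity = (λ f n _ → ℤ.+-identityˡ (f n)) , (λ f n _ → ℤ.+-identityʳ (f n)) }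
          ; inverse = (λ f n _ → ℤ.+-inverseˡ (f n)) , (λ f n _ → ℤ.+-inverseʳ (f n))
          ; ⁻¹-cong = λ p n n≤N → cong -_ (p n n≤N) }
        ; comm = λ f g n _ → ℤ.+-comm (f n) (g n) }
      ; *-cong     = ⊛-cong
      ; *-assoc    = ⊛-assoc
      ; *-identity = ⊛-identityˡ , λ f n n≤N → trans (⊛-comm f one n n≤N) (⊛-identityˡ f n n≤N)
      ; distrib    = ⊛-distribˡ , λ f g h n n≤N → trans (⊛-comm (g ⊕ h) f n n≤N)
          (trans (⊛-distribˡ f g h n n≤N) (cong₂ ℤ._+_ (⊛-comm f g n n≤N) (⊛-comm f h n n≤N)))
      }
    ; *-comm = ⊛-comm }
  }

-- Integer constants.  `constant (+ 1)` is literally `one`, so that the solver's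
-- `con (+ 1)` matches goals written with `one`.
constant : ℤ → FPS
constant (+ 1) = one
constant c     = λ { zero → c ; (suc _) → + 0 }

constant-zero : ∀ c → constant c 0 ≡ c
constant-zero (+ 0)           = refl
constant-zero (+ 1)           = refl
constant-zero (+ suc (suc _)) = refl
constant-zero -[1+ _ ]        = refl

constant-suc : ∀ c n → constant c (suc n) ≡ + 0
constant-suc (+ 0)           n = refl
constant-suc (+ 1)           n = refl
constant-suc (+ suc (suc _)) n = refl
constant-suc -[1+ _ ]        n = refl

constant-⊛ : ∀ c f n → (constant c ⊛ f) n ≡ c ℤ.* f n
constant-⊛ c f n = begin
  (constant c ⊛ f) n
    ≡⟨ sumTo-head n _ ⟩
  constant c 0 ℤ.* f n ℤ.+ sumTo n (λ i → constant c (suc i) ℤ.* f (n ∸ suc i))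
    ≡⟨ cong₂ ℤ._+_ (cong (ℤ._* f n) (constant-zero c))
                   (sumTo-zero n (λ i _ → cong (ℤ._* f (n ∸ suc i)) (constant-suc c i))) ⟩
  c ℤ.* f n ℤ.+ + 0
    ≡⟨ ℤ.+-identityʳ _ ⟩
  c ℤ.* f n
    ∎
  where open ≡-Reasoning

constant-unique : ∀ {N c f} → f 0 ≡ c → (∀ n → f (suc n) ≡ + 0) → f ≈[ N ] constant c
constant-unique {c = c} f0≡c _     zero    _ = trans f0≡c (sym (constant-zero c))
constant-unique {c = c} _    f1+n≡0 (suc n) _ = trans (f1+n≡0 n) (sym (constant-suc c n))

constantMorphism : ∀ N → ℤ.+-*-rawRing -Raw-AlmostCommutative⟶ fromCommutativeRing (seriesRing N)
constantMorphism N = record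
  { ⟦_⟧    = constant
  ; +-homo = λ a b → ≈-sym (constant-unique (cong₂ ℤ._+_ (constant-zero a) (constant-zero b))
                                            (λ n → cong₂ ℤ._+_ (constant-suc a n) (constant-suc b n)))
  ; *-homo = λ a b → ≈-sym (constant-unique
                       (trans (constant-⊛ a (constant b) 0) (cong (a ℤ.*_) (constant-zero b)))
                       (λ n → trans (constant-⊛ a (constant b) (suc n))
                                     (trans (cong (a ℤ.*_) (constant-suc b n)) (ℤ.*-zeroʳ a))))
  ; -‿homo = λ a → ≈-sym (constant-unique (cong -_ (constant-zero a)) (λ n → cong -_ (constant-suc a n)))
  ; 0-homo = ≈-sym (constant-unique refl (λ _ → refl))
  ; 1-homo = λ _ _ → refl
  }
  where open CommutativeRing (seriesRing N) using () renaming (sym to ≈-sym)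

module SeriesReasoning (N : ℕ) where
  open CommutativeRing (seriesRing N) public
    using (+-cong; *-cong; -‿cong; *-comm; *-identityˡ; *-identityʳ; -‿inverseʳ; setoid)
    renaming (refl to ≈-refl; sym to ≈-sym; trans to ≈-trans; reflexive to ≈-reflexive)
  open import Relation.Binary.Reasoning.Setoid setoid public
  open RingSolver ℤ.+-*-rawRing (fromCommutativeRing (seriesRing N)) (constantMorphism N)
                  (λ a b → map (λ a≡b → ≈-reflexive (cong constant a≡b)) (dec⇒maybe (a ℤ.≟ b)))
    public using (solve; _:=_; con; _:+_; _:*_; _:-_)

  ⊛-congˡ : ∀ f {g h} → g ≈[ N ] h → f ⊛ g ≈[ N ] f ⊛ h
  ⊛-congˡ f = *-cong (≈-refl {f})

  ⊛-congʳ : ∀ h {f g} → f ≈[ N ] g → f ⊛ h ≈[ N ] g ⊛ h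
  ⊛-congʳ h f≈g = *-cong f≈g (≈-refl {h})

mono-≡ : ∀ {a n} → a ≡ n → mono a n ≡ + 1
mono-≡ {a} {n} a≡n with a ℕ.≟ n
... | yes _   = refl
... | no a≢n = contradiction a≡n a≢n

mono-≢ : ∀ {a n} → a ≢ n → mono a n ≡ + 0
mono-≢ {a} {n} a≢n with a ℕ.≟ n
... | yes a≡n = contradiction a≡n a≢n
... | no _    = refl

mono-⊛ : ∀ {a n} f → a ≤ n → (mono a ⊛ f) n ≡ f (n ∸ a)
mono-⊛ {a} {n} f a≤n = begin
  (mono a ⊛ f) n
    ≡⟨ sumTo-single (suc n) a _ (s≤s a≤n) (λ i _ i≢a → cong (ℤ._* f (n ∸ i)) (mono-≢ (≢-sym i≢a))) ⟩
  mono a a ℤ.* f (n ∸ a)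
    ≡⟨ cong (ℤ._* f (n ∸ a)) (mono-≡ {a} refl) ⟩
  + 1 ℤ.* f (n ∸ a)
    ≡⟨ ℤ.*-identityˡ _ ⟩
  f (n ∸ a)
    ∎
  where open ≡-Reasoning

mono-zero : ∀ {N} → mono 0 ≈[ N ] one
mono-zero zero    _ = refl
mono-zero (suc n) _ = refl

infix 4 q^_∣_
q^_∣_ : ℕ → FPS → Set
q^ a ∣ f = ∀ n → n < a → f n ≡ + 0

q^∣mono : ∀ a → q^ a ∣ mono a
q^∣mono a n n<a = mono-≢ (≢-sym (ℕ.<⇒≢ n<a))

q^∣-⊛ˡ : ∀ {a f} g → q^ a ∣ f → q^ a ∣ f ⊛ g
q^∣-⊛ˡ g q^a∣f n n<a = sumTo-zero (suc n) (λ i i<1+n →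
  trans (cong (ℤ._* g (n ∸ i)) (q^a∣f i (ℕ.≤-<-trans (ℕ.≤-pred i<1+n) n<a))) (ℤ.*-zeroˡ (g (n ∸ i))))

q^∣-⊛ʳ : ∀ {a g} f → q^ a ∣ g → q^ a ∣ f ⊛ g
q^∣-⊛ʳ {g = g} f q^a∣g n n<a = trans (⊛-comm f g n ℕ.≤-refl) (q^∣-⊛ˡ f q^a∣g n n<a)

q^∣-≤ : ∀ {a b f} → b ≤ a → q^ a ∣ f → q^ b ∣ f
q^∣-≤ b≤a q^a∣f n n<b = q^a∣f n (ℕ.<-≤-trans n<b b≤a)

q^∣⇒≈0 : ∀ {N a f} → N < a → q^ a ∣ f → f ≈[ N ] 0ₛ
q^∣⇒≈0 N<a q^a∣f n n≤N = q^a∣f n (ℕ.≤-<-trans n≤N N<a)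

mono-⊛-mono : ∀ {N} a b {c} → a ℕ.+ b ≡ c → mono a ⊛ mono b ≈[ N ] mono c
mono-⊛-mono a b refl n _ with a ℕ.≤? n
... | no a≰n  = trans (q^∣-⊛ˡ (mono b) (q^∣mono a) n (ℕ.≰⇒> a≰n))
                      (sym (q^∣mono (a ℕ.+ b) n (ℕ.<-≤-trans (ℕ.≰⇒> a≰n) (ℕ.m≤m+n a b))))
... | yes a≤n = trans (mono-⊛ (mono b) a≤n) (shifted (b ℕ.≟ n ∸ a))
  where
  shifted : Dec (b ≡ n ∸ a) → mono b (n ∸ a) ≡ mono (a ℕ.+ b) n
  shifted (yes b≡n-a) = trans (mono-≡ b≡n-a) (sym (mono-≡ (trans (cong (a ℕ.+_) b≡n-a) (ℕ.m+[n∸m]≡n a≤n))))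
  shifted (no b≢n-a)  = trans (mono-≢ b≢n-a) (sym (mono-≢ (λ a+b≡n →
    b≢n-a (trans (sym (ℕ.m+n∸m≡n a b)) (cong (_∸ a) a+b≡n)))))

-- Inverses and fractions

-- `invList` reads earlier coefficients through a `where`-local `nth`, which cannot be named
-- here; any function satisfying the defining equations of `nth` reads off `inv f`.
invList-lookup : (nth : ℕ → List ℤ → ℤ) → (∀ x xs → nth 0 (x ∷ xs) ≡ x) →
                 (∀ i x xs → nth (suc i) (x ∷ xs) ≡ nth i xs) →
                 ∀ f {N i} → i ≤ N → nth i (invList f N) ≡ inv f (N ∸ i)
invList-lookup nth head tail f {zero}  {zero}  _         = head (+ 1) []
invList-lookup nth head tail f {suc N} {zero}  _         = head _ _
invList-lookup nth head tail f {suc N} {suc i} (s≤s i≤N) = trans (tail i _ _) (invList-lookup nth head tail f i≤N)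

inv-suc : ∀ f N → inv f (suc N) ≡ - sumTo (suc N) (λ i → f (suc i) ℤ.* inv f (N ∸ i))
inv-suc f N with invList f N | invList-lookup _ (λ _ _ → refl) (λ _ _ _ → refl) f {N}
... | _ | lookup = cong -_ (sumTo-cong (suc N) (λ i i<1+N → cong (f (suc i) ℤ.*_) (lookup (ℕ.≤-pred i<1+N))))

-- Constant term 1, the normalisation that `inv` assumes.  A record, so that `f` can be
-- inferred from a proof of `Unit f`.
record Unit (f : FPS) : Set where
  constructor unit
  field constant-one : f 0 ≡ + 1
open Unit

Unit-⊛ : ∀ {f g} → Unit f → Unit g → Unit (f ⊛ g)
Unit-⊛ (unit f0≡1) (unit g0≡1) = unit (trans (ℤ.+-identityˡ _) (cong₂ ℤ._*_ f0≡1 g0≡1))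

⊛-inverseʳ : ∀ {N f} → Unit f → f ⊛ inv f ≈[ N ] one
⊛-inverseʳ (unit f0≡1) zero    _ = trans (ℤ.+-identityˡ _) (cong (ℤ._* + 1) f0≡1)
⊛-inverseʳ {f = f} (unit f0≡1) (suc n) _ = begin
  (f ⊛ inv f) (suc n)          ≡⟨ sumTo-head (suc n) _ ⟩
  f 0 ℤ.* inv f (suc n) ℤ.+ S  ≡⟨ cong₂ (λ a b → a ℤ.* b ℤ.+ S) f0≡1 (inv-suc f n) ⟩
  + 1 ℤ.* - S ℤ.+ S            ≡⟨ cong (ℤ._+ S) (ℤ.*-identityˡ (- S)) ⟩
  - S ℤ.+ S                    ≡⟨ ℤ.+-inverseˡ S ⟩
  + 0                          ∎
  where
  open ≡-Reasoning
  S = sumTo (suc n) (λ i → f (suc i) ℤ.* inv f (n ∸ i))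

infixl 7 _÷_
_÷_ : FPS → FPS → FPS
f ÷ g = f ⊛ inv g

module _ {N : ℕ} where
  open SeriesReasoning N

  ÷-unique : ∀ {a b c} → Unit b → a ⊛ b ≈[ N ] c → a ≈[ N ] c ÷ b
  ÷-unique {a} {b} {c} ub ab≈c = begin
    a                ≈⟨ ≈-sym (*-identityʳ a) ⟩
    a ⊛ one          ≈⟨ ⊛-congˡ a (≈-sym (⊛-inverseʳ ub)) ⟩
    a ⊛ (b ⊛ inv b)  ≈⟨ solve 3 (λ a b b⁻¹ → a :* (b :* b⁻¹) := a :* b :* b⁻¹) ≈-refl a b (inv b) ⟩
    a ⊛ b ⊛ inv b    ≈⟨ ⊛-congʳ (inv b) ab≈c ⟩
    c ÷ b            ∎

  ÷-cross : ∀ a {b} c {d} → Unit b → Unit d → a ⊛ d ≈[ N ] c ⊛ b → a ÷ b ≈[ N ] c ÷ d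
  ÷-cross a {b} c {d} ub ud ad≈cb = ÷-unique ud (begin
    a ÷ b ⊛ d        ≈⟨ solve 3 (λ a b⁻¹ d → a :* b⁻¹ :* d := a :* d :* b⁻¹) ≈-refl a (inv b) d ⟩
    a ⊛ d ⊛ inv b    ≈⟨ ⊛-congʳ (inv b) ad≈cb ⟩
    c ⊛ b ⊛ inv b    ≈⟨ solve 3 (λ c b b⁻¹ → c :* b :* b⁻¹ := c :* (b :* b⁻¹)) ≈-refl c b (inv b) ⟩
    c ⊛ (b ⊛ inv b)  ≈⟨ ⊛-congˡ c (⊛-inverseʳ ub) ⟩
    c ⊛ one          ≈⟨ *-identityʳ c ⟩
    c                ∎)

  ÷-⊛-÷ : ∀ a {b} c {d} → Unit b → Unit d → a ÷ b ⊛ (c ÷ d) ≈[ N ] (a ⊛ c) ÷ (b ⊛ d)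
  ÷-⊛-÷ a {b} c {d} ub ud = ÷-unique (Unit-⊛ ub ud) (begin
    a ÷ b ⊛ (c ÷ d) ⊛ (b ⊛ d)
      ≈⟨ solve 6 (λ a b⁻¹ c d⁻¹ b d → a :* b⁻¹ :* (c :* d⁻¹) :* (b :* d) := a :* c :* (b :* b⁻¹) :* (d :* d⁻¹))
               ≈-refl a (inv b) c (inv d) b d ⟩
    a ⊛ c ⊛ (b ⊛ inv b) ⊛ (d ⊛ inv d)
      ≈⟨ *-cong (⊛-congˡ (a ⊛ c) (⊛-inverseʳ ub)) (⊛-inverseʳ ud) ⟩
    a ⊛ c ⊛ one ⊛ one
      ≈⟨ solve 1 (λ x → x :* con (+ 1) :* con (+ 1) := x) ≈-refl (a ⊛ c) ⟩
    a ⊛ c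
      ∎)

-- q-Pochhammer symbols

poch-unit : ∀ a n → 1 ≤ a → Unit (poch a n)
poch-unit a zero    _   = unit refl
poch-unit a (suc n) 1≤a = Unit-⊛ (poch-unit a n 1≤a) (unit {one ⊖ mono (a ℕ.+ 2 ℕ.* n)}
  (cong (λ x → + 1 ℤ.- x) (q^∣mono (a ℕ.+ 2 ℕ.* n) 0 (ℕ.≤-trans 1≤a (ℕ.m≤m+n a _)))))

pochInf-unit : ∀ a → 1 ≤ a → Unit (pochInf a)
pochInf-unit a 1≤a = unit (constant-one (poch-unit a 1 1≤a))

module _ {N : ℕ} where
  open SeriesReasoning N

  poch-+ : ∀ a m n → poch a (m ℕ.+ n) ≈[ N ] poch a m ⊛ poch (a ℕ.+ 2 ℕ.* m) n
  poch-+ a m zero rewrite ℕ.+-identityʳ m = ≈-sym (*-identityʳ (poch a m))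
  poch-+ a m (suc n) = begin
    poch a (m ℕ.+ suc n)
      ≈⟨ ≈-reflexive (cong (poch a) (ℕ.+-suc m n)) ⟩
    poch a (m ℕ.+ n) ⊛ (one ⊖ mono (a ℕ.+ 2 ℕ.* (m ℕ.+ n)))
      ≈⟨ *-cong (poch-+ a m n) (≈-reflexive (cong (λ e → one ⊖ mono e) exponent)) ⟩
    poch a m ⊛ poch (a ℕ.+ 2 ℕ.* m) n ⊛ factor
      ≈⟨ solve 3 (λ x y z → x :* y :* z := x :* (y :* z)) ≈-refl (poch a m) (poch (a ℕ.+ 2 ℕ.* m) n) factor ⟩
    poch a m ⊛ (poch (a ℕ.+ 2 ℕ.* m) n ⊛ factor)
      ∎
    where
    factor = one ⊖ mono (a ℕ.+ 2 ℕ.* m ℕ.+ 2 ℕ.* n)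
    exponent : a ℕ.+ 2 ℕ.* (m ℕ.+ n) ≡ a ℕ.+ 2 ℕ.* m ℕ.+ 2 ℕ.* n
    exponent = trans (cong (a ℕ.+_) (ℕ.*-distribˡ-+ 2 m n)) (sym (ℕ.+-assoc a (2 ℕ.* m) (2 ℕ.* n)))

  poch-suc : ∀ a n → poch a (suc n) ≈[ N ] (one ⊖ mono a) ⊛ poch (a ℕ.+ 2) n
  poch-suc a n = begin
    poch a (1 ℕ.+ n)
      ≈⟨ poch-+ a 1 n ⟩
    one ⊛ (one ⊖ mono (a ℕ.+ 0)) ⊛ poch (a ℕ.+ 2) n
      ≈⟨ ⊛-congʳ (poch (a ℕ.+ 2) n) (*-identityˡ (one ⊖ mono (a ℕ.+ 0))) ⟩
    (one ⊖ mono (a ℕ.+ 0)) ⊛ poch (a ℕ.+ 2) n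
      ≈⟨ ≈-reflexive (cong (λ e → (one ⊖ mono e) ⊛ poch (a ℕ.+ 2) n) (ℕ.+-identityʳ a)) ⟩
    (one ⊖ mono a) ⊛ poch (a ℕ.+ 2) n
      ∎

  one⊖mono≈one : ∀ {e} → N < e → one ⊖ mono e ≈[ N ] one
  one⊖mono≈one N<e n n≤N = trans (cong (λ x → one n ℤ.- x) (q^∣⇒≈0 N<e (q^∣mono _) n n≤N)) (ℤ.+-identityʳ (one n))

  poch≈one : ∀ {a} n → N < a → poch a n ≈[ N ] one
  poch≈one zero        _   = ≈-refl
  poch≈one {a} (suc n) N<a = begin
    poch a n ⊛ (one ⊖ mono (a ℕ.+ 2 ℕ.* n))
      ≈⟨ *-cong (poch≈one n N<a) (one⊖mono≈one (ℕ.<-≤-trans N<a (ℕ.m≤m+n a _))) ⟩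
    one ⊛ one
      ≈⟨ *-identityˡ one ⟩
    one
      ∎

pochInf≈poch : ∀ {N} a {M} → N < M → pochInf a ≈[ N ] poch a M
pochInf≈poch {N} a {M} N<M n n≤N = ≈-sym (begin
  poch a M                                              ≈⟨ ≈-reflexive (cong (poch a) (sym (ℕ.m+[n∸m]≡n 1+n≤M))) ⟩
  poch a (suc n ℕ.+ (M ∸ suc n))                        ≈⟨ poch-+ a (suc n) (M ∸ suc n) ⟩
  poch a (suc n) ⊛ poch (a ℕ.+ 2 ℕ.* suc n) (M ∸ suc n) ≈⟨ ⊛-congˡ (poch a (suc n)) (poch≈one (M ∸ suc n) n<a+2+2n) ⟩
  poch a (suc n) ⊛ one                                  ≈⟨ *-identityʳ (poch a (suc n)) ⟩
  poch a (suc n)                                        ∎) n ℕ.≤-refl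
  where
  open SeriesReasoning n
  1+n≤M = ℕ.≤-trans (s≤s n≤N) N<M
  n<a+2+2n = ℕ.<-≤-trans (ℕ.n<1+n n) (ℕ.≤-trans (ℕ.m≤m+n (suc n) (suc n ℕ.+ 0)) (ℕ.m≤n+m _ a))

module _ {N : ℕ} where
  open SeriesReasoning N

  pochInf-split : ∀ a n {b} → a ℕ.+ 2 ℕ.* n ≡ b → pochInf a ≈[ N ] poch a n ⊛ pochInf b
  pochInf-split a n refl = begin
    pochInf a                                ≈⟨ pochInf≈poch a (ℕ.<-≤-trans N<1+N (ℕ.m≤n+m (suc N) n)) ⟩
    poch a (n ℕ.+ suc N)                     ≈⟨ poch-+ a n (suc N) ⟩
    poch a n ⊛ poch (a ℕ.+ 2 ℕ.* n) (suc N)  ≈⟨ ⊛-congˡ (poch a n) (≈-sym (pochInf≈poch (a ℕ.+ 2 ℕ.* n) N<1+N)) ⟩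
    poch a n ⊛ pochInf (a ℕ.+ 2 ℕ.* n)       ∎
    where N<1+N = ℕ.n<1+n N

sumSeries : ℕ → (ℕ → FPS) → FPS
sumSeries L T n = sumTo L (λ m → T m n)

module _ {N : ℕ} where

  sumSeries-cong : ∀ L {T V} → (∀ m → m < L → T m ≈[ N ] V m) → sumSeries L T ≈[ N ] sumSeries L V
  sumSeries-cong L T≈V n n≤N = sumTo-cong L (λ m m<L → T≈V m m<L n n≤N)

  sumSeries-⊖ : ∀ L T V → sumSeries L (λ m → T m ⊖ V m) ≈[ N ] sumSeries L T ⊖ sumSeries L V
  sumSeries-⊖ L T V n _ = trans (sumTo-+ L (λ m → T m n) (λ m → - V m n))
                                (cong (λ x → sumSeries L T n ℤ.+ x) (sumTo-neg L (λ m → V m n)))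

  ⊛-sumSeries : ∀ f L T → f ⊛ sumSeries L T ≈[ N ] sumSeries L (λ m → f ⊛ T m)
  ⊛-sumSeries f L T n _ = trans (sumTo-cong (suc n) (λ i _ → sym (sumTo-*ˡ L (f i) (λ m → T m (n ∸ i)))))
                                (sumTo-comm (suc n) L (λ i m → f i ℤ.* T m (n ∸ i)))

  sumSeries-comm : ∀ L M (X : ℕ → ℕ → FPS) →
                   sumSeries L (λ i → sumSeries M (X i)) ≈[ N ] sumSeries M (λ j → sumSeries L (λ i → X i j))
  sumSeries-comm L M X n _ = sumTo-comm L M (λ i j → X i j n)

  sumSeries-telescope : ∀ L (D : ℕ → FPS) → sumSeries L (λ m → D m ⊖ D (suc m)) ≈[ N ] D 0 ⊖ D L
  sumSeries-telescope L D n _ = sumTo-telescope L (λ m → D m n)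

  sumInf≈sumSeries : ∀ {L} T → N < L → (∀ m → q^ m ∣ T m) → sumInf T ≈[ N ] sumSeries L T
  sumInf≈sumSeries T N<L q^m∣Tm n n≤N =
    sym (sumTo-extend (λ m → T m n) (ℕ.≤-trans (s≤s n≤N) N<L) (λ m n<m → q^m∣Tm m n n<m))

  sumInf≈head : ∀ {a} T → N < a → (∀ m → q^ a ∣ T (suc m)) → sumInf T ≈[ N ] T 0
  sumInf≈head T N<a q^a∣T n n≤N = sumTo-single (suc n) 0 (λ m → T m n) (s≤s z≤n) vanish
    where
    vanish : ∀ m → m < suc n → m ≢ 0 → T m n ≡ + 0
    vanish zero    _ 0≢0 = contradiction refl 0≢0
    vanish (suc m) _ _   = q^a∣T m n (ℕ.≤-<-trans n≤N N<a)

-- The q-binomial theorem in base q²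

binomialTerm : ℕ → ℕ → ℕ → FPS
binomialTerm c s m = poch c m ÷ poch 2 m ⊛ mono (s ℕ.* m)

binomialSeries : ℕ → ℕ → FPS
binomialSeries c s = sumInf (binomialTerm c s)

q^∣binomialTerm : ∀ c s m → q^ s ℕ.* m ∣ binomialTerm c s m
q^∣binomialTerm c s m = q^∣-⊛ʳ (poch c m ÷ poch 2 m) (q^∣mono (s ℕ.* m))

q^m∣binomialTerm : ∀ c {s} → 1 ≤ s → ∀ m → q^ m ∣ binomialTerm c s m
q^m∣binomialTerm c {s} 1≤s m = q^∣-≤ (ℕ.m≤n*m m s {{ℕ.>-nonZero 1≤s}}) (q^∣binomialTerm c s m)

module BinomialExponents where
  open ℕ-Solver.+-*-Solver

  shiftˡ : ∀ c s m → c ℕ.+ s ℕ.+ (s ℕ.+ 2) ℕ.* m ≡ c ℕ.+ 2 ℕ.* m ℕ.+ s ℕ.* suc m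
  shiftˡ = solve 3 (λ c s m → c :+ s :+ (s :+ con 2) :* m := c :+ con 2 :* m :+ s :* (con 1 :+ m)) refl

  shiftʳ : ∀ s m → s ℕ.* suc m ℕ.+ (2 ℕ.+ 2 ℕ.* m) ≡ (s ℕ.+ 2) ℕ.* suc m
  shiftʳ = solve 2 (λ s m → s :* (con 1 :+ m) :+ (con 2 :+ con 2 :* m) := (s :+ con 2) :* (con 1 :+ m)) refl

module _ {N : ℕ} where
  open SeriesReasoning N

  binomialTerm-zero : ∀ c s → binomialTerm c s 0 ≈[ N ] one
  binomialTerm-zero c s = begin
    one ÷ one ⊛ mono (s ℕ.* 0)  ≈⟨ ⊛-congʳ (mono (s ℕ.* 0)) (⊛-inverseʳ (unit {one} refl)) ⟩
    one ⊛ mono (s ℕ.* 0)        ≈⟨ *-identityˡ (mono (s ℕ.* 0)) ⟩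
    mono (s ℕ.* 0)              ≈⟨ ≈-reflexive (cong mono (ℕ.*-zeroʳ s)) ⟩
    mono 0                      ≈⟨ mono-zero ⟩
    one                         ∎

  -- Both sides equal (q^c;q²)ₘ (1 − q^(c+2m)) q^(s(m+1)) / (q²;q²)ₘ; on the right this
  -- shows after cancelling the factor 1 − q^(2m+2) of (q²;q²)ₘ₊₁.
  binomialTerm-step : ∀ c s m →
    mono s ⊛ binomialTerm c s m ⊖ mono (c ℕ.+ s) ⊛ binomialTerm c (s ℕ.+ 2) m
      ≈[ N ] binomialTerm c s (suc m) ⊖ binomialTerm c (s ℕ.+ 2) (suc m)
  binomialTerm-step c s m = begin
    mono s ⊛ (P ÷ Q ⊛ mono (s ℕ.* m)) ⊖ mono (c ℕ.+ s) ⊛ (P ÷ Q ⊛ mono ((s ℕ.+ 2) ℕ.* m))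
      ≈⟨ solve 6 (λ P Q⁻¹ a b c d → a :* (P :* Q⁻¹ :* b) :- c :* (P :* Q⁻¹ :* d) := P :* (a :* b :- c :* d) :* Q⁻¹)
               ≈-refl P (inv Q) (mono s) (mono (s ℕ.* m)) (mono (c ℕ.+ s)) (mono ((s ℕ.+ 2) ℕ.* m)) ⟩
    (P ⊛ (mono s ⊛ mono (s ℕ.* m) ⊖ mono (c ℕ.+ s) ⊛ mono ((s ℕ.+ 2) ℕ.* m))) ÷ Q
      ≈⟨ ⊛-congʳ (inv Q) (⊛-congˡ P (+-cong q^s·q^sm≈X (-‿cong q^[c+s]·q^[s+2]m≈ZX))) ⟩
    (P ⊛ (X ⊖ Z ⊛ X)) ÷ Q
      ≈⟨ ÷-cross (P ⊛ (X ⊖ Z ⊛ X)) (P ⊛ (one ⊖ Z) ⊛ (X ⊖ X ⊛ Y))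
                 (poch-unit 2 m (s≤s z≤n)) (poch-unit 2 (suc m) (s≤s z≤n))
           (solve 5 (λ P Q X Y Z → P :* (X :- Z :* X) :* (Q :* (con (+ 1) :- Y))
                                := P :* (con (+ 1) :- Z) :* (X :- X :* Y) :* Q) ≈-refl P Q X Y Z) ⟩
    (P ⊛ (one ⊖ Z) ⊛ (X ⊖ X ⊛ Y)) ÷ (Q ⊛ (one ⊖ Y))
      ≈⟨ ⊛-congʳ (inv (Q ⊛ (one ⊖ Y))) (⊛-congˡ (P ⊛ (one ⊖ Z)) (+-cong (≈-refl {X}) (-‿cong XY≈q^[s+2][m+1]))) ⟩
    (P ⊛ (one ⊖ Z) ⊛ (X ⊖ mono ((s ℕ.+ 2) ℕ.* suc m))) ÷ (Q ⊛ (one ⊖ Y))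
      ≈⟨ solve 4 (λ P′ Q′⁻¹ X W → P′ :* (X :- W) :* Q′⁻¹ := P′ :* Q′⁻¹ :* X :- P′ :* Q′⁻¹ :* W)
               ≈-refl (P ⊛ (one ⊖ Z)) (inv (Q ⊛ (one ⊖ Y))) X (mono ((s ℕ.+ 2) ℕ.* suc m)) ⟩
    binomialTerm c s (suc m) ⊖ binomialTerm c (s ℕ.+ 2) (suc m)
      ∎
    where
    P = poch c m
    Q = poch 2 m
    X = mono (s ℕ.* suc m)
    Y = mono (2 ℕ.+ 2 ℕ.* m)
    Z = mono (c ℕ.+ 2 ℕ.* m)
    q^s·q^sm≈X : mono s ⊛ mono (s ℕ.* m) ≈[ N ] X
    q^s·q^sm≈X = mono-⊛-mono s (s ℕ.* m) (sym (ℕ.*-suc s m))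
    q^[c+s]·q^[s+2]m≈ZX : mono (c ℕ.+ s) ⊛ mono ((s ℕ.+ 2) ℕ.* m) ≈[ N ] Z ⊛ X
    q^[c+s]·q^[s+2]m≈ZX = ≈-trans (mono-⊛-mono (c ℕ.+ s) ((s ℕ.+ 2) ℕ.* m) (BinomialExponents.shiftˡ c s m))
                                   (≈-sym (mono-⊛-mono (c ℕ.+ 2 ℕ.* m) (s ℕ.* suc m) refl))
    XY≈q^[s+2][m+1] : X ⊛ Y ≈[ N ] mono ((s ℕ.+ 2) ℕ.* suc m)
    XY≈q^[s+2][m+1] = mono-⊛-mono (s ℕ.* suc m) (2 ℕ.+ 2 ℕ.* m) (BinomialExponents.shiftʳ s m)

  binomialSum-telescope : ∀ c s L →
    (one ⊖ mono s) ⊛ sumSeries L (binomialTerm c s) ⊖ (one ⊖ mono (c ℕ.+ s)) ⊛ sumSeries L (binomialTerm c (s ℕ.+ 2))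
      ≈[ N ] (binomialTerm c s 0 ⊖ binomialTerm c (s ℕ.+ 2) 0) ⊖ (binomialTerm c s L ⊖ binomialTerm c (s ℕ.+ 2) L)
  binomialSum-telescope c s L = begin
    (one ⊖ mono s) ⊛ S ⊖ (one ⊖ mono (c ℕ.+ s)) ⊛ S₂
      ≈⟨ solve 4 (λ a b S S₂ → (con (+ 1) :- a) :* S :- (con (+ 1) :- b) :* S₂ := (S :- S₂) :- (a :* S :- b :* S₂))
               ≈-refl (mono s) (mono (c ℕ.+ s)) S S₂ ⟩
    (S ⊖ S₂) ⊖ (mono s ⊛ S ⊖ mono (c ℕ.+ s) ⊛ S₂)
      ≈⟨ +-cong (≈-sym (sumSeries-⊖ L (binomialTerm c s) (binomialTerm c (s ℕ.+ 2))))
                (-‿cong (+-cong (⊛-sumSeries (mono s) L (binomialTerm c s))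
                                (-‿cong (⊛-sumSeries (mono (c ℕ.+ s)) L (binomialTerm c (s ℕ.+ 2)))))) ⟩
    sumSeries L D ⊖ (sumSeries L (λ m → mono s ⊛ binomialTerm c s m)
                      ⊖ sumSeries L (λ m → mono (c ℕ.+ s) ⊛ binomialTerm c (s ℕ.+ 2) m))
      ≈⟨ +-cong (≈-refl {sumSeries L D}) (-‿cong (≈-trans (≈-sym (sumSeries-⊖ L _ _))
                                                          (sumSeries-cong L (λ m _ → binomialTerm-step c s m)))) ⟩
    sumSeries L D ⊖ sumSeries L (λ m → D (suc m))
      ≈⟨ ≈-sym (sumSeries-⊖ L D (λ m → D (suc m))) ⟩
    sumSeries L (λ m → D m ⊖ D (suc m))
      ≈⟨ sumSeries-telescope L D ⟩
    D 0 ⊖ D L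
      ∎
    where
    S  = sumSeries L (binomialTerm c s)
    S₂ = sumSeries L (binomialTerm c (s ℕ.+ 2))
    D : ℕ → FPS
    D m = binomialTerm c s m ⊖ binomialTerm c (s ℕ.+ 2) m

  -- `binomialSum-telescope` with L = N + 1: the boundary term at m = 0 is 1 − 1, and the
  -- one at m = L is divisible by q^(sL), which vanishes modulo q^(N+1) as s ≥ 1.
  binomialSeries-recurrence : ∀ c s → 1 ≤ s →
    (one ⊖ mono s) ⊛ binomialSeries c s ≈[ N ] (one ⊖ mono (c ℕ.+ s)) ⊛ binomialSeries c (s ℕ.+ 2)
  binomialSeries-recurrence c s 1≤s n n≤N = ℤ.i-j≡0⇒i≡j _ _ ((begin
    (one ⊖ mono s) ⊛ binomialSeries c s ⊖ (one ⊖ mono (c ℕ.+ s)) ⊛ binomialSeries c (s ℕ.+ 2)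
      ≈⟨ +-cong (⊛-congˡ (one ⊖ mono s) (sumInf≈sumSeries (binomialTerm c s) ℕ.≤-refl (q^m∣binomialTerm c 1≤s)))
                (-‿cong (⊛-congˡ (one ⊖ mono (c ℕ.+ s))
                                 (sumInf≈sumSeries (binomialTerm c (s ℕ.+ 2)) ℕ.≤-refl (q^m∣binomialTerm c 1≤s+2)))) ⟩
    (one ⊖ mono s) ⊛ sumSeries L (binomialTerm c s) ⊖ (one ⊖ mono (c ℕ.+ s)) ⊛ sumSeries L (binomialTerm c (s ℕ.+ 2))
      ≈⟨ binomialSum-telescope c s L ⟩
    (binomialTerm c s 0 ⊖ binomialTerm c (s ℕ.+ 2) 0) ⊖ (binomialTerm c s L ⊖ binomialTerm c (s ℕ.+ 2) L)
      ≈⟨ +-cong (≈-trans (+-cong (binomialTerm-zero c s) (-‿cong (binomialTerm-zero c (s ℕ.+ 2)))) (-‿inverseʳ one))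
                (-‿cong (+-cong (q^∣⇒≈0 ℕ.≤-refl (q^m∣binomialTerm c 1≤s L))
                                (-‿cong (q^∣⇒≈0 ℕ.≤-refl (q^m∣binomialTerm c 1≤s+2 L))))) ⟩
    0ₛ ⊖ (0ₛ ⊖ 0ₛ)
      ∎) n n≤N)
    where
    L = suc N
    1≤s+2 = ℕ.≤-trans 1≤s (ℕ.m≤m+n s 2)

  poch-⊛-binomialSeries : ∀ c s M → 1 ≤ s →
    poch s M ⊛ binomialSeries c s ≈[ N ] poch (c ℕ.+ s) M ⊛ binomialSeries c (s ℕ.+ 2 ℕ.* M)
  poch-⊛-binomialSeries c s zero    _   = ⊛-congˡ one (≈-reflexive (cong (binomialSeries c) (sym (ℕ.+-identityʳ s))))
  poch-⊛-binomialSeries c s (suc M) 1≤s = begin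
    poch s (suc M) ⊛ H s
      ≈⟨ ⊛-congʳ (H s) (poch-suc s M) ⟩
    u ⊛ poch (s ℕ.+ 2) M ⊛ H s
      ≈⟨ solve 3 (λ u p h → u :* p :* h := p :* (u :* h)) ≈-refl u (poch (s ℕ.+ 2) M) (H s) ⟩
    poch (s ℕ.+ 2) M ⊛ (u ⊛ H s)
      ≈⟨ ⊛-congˡ (poch (s ℕ.+ 2) M) (binomialSeries-recurrence c s 1≤s) ⟩
    poch (s ℕ.+ 2) M ⊛ (v ⊛ H (s ℕ.+ 2))
      ≈⟨ solve 3 (λ v p h → p :* (v :* h) := v :* (p :* h)) ≈-refl v (poch (s ℕ.+ 2) M) (H (s ℕ.+ 2)) ⟩
    v ⊛ (poch (s ℕ.+ 2) M ⊛ H (s ℕ.+ 2))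
      ≈⟨ ⊛-congˡ v (poch-⊛-binomialSeries c (s ℕ.+ 2) M (ℕ.≤-trans 1≤s (ℕ.m≤m+n s 2))) ⟩
    v ⊛ (poch (c ℕ.+ (s ℕ.+ 2)) M ⊛ H (s ℕ.+ 2 ℕ.+ 2 ℕ.* M))
      ≈⟨ ≈-reflexive (cong₂ (λ a b → v ⊛ (poch a M ⊛ H b)) (sym (ℕ.+-assoc c s 2)) exponent) ⟩
    v ⊛ (poch (c ℕ.+ s ℕ.+ 2) M ⊛ H (s ℕ.+ 2 ℕ.* suc M))
      ≈⟨ solve 3 (λ v p h → v :* (p :* h) := v :* p :* h) ≈-refl v (poch (c ℕ.+ s ℕ.+ 2) M) (H (s ℕ.+ 2 ℕ.* suc M)) ⟩
    v ⊛ poch (c ℕ.+ s ℕ.+ 2) M ⊛ H (s ℕ.+ 2 ℕ.* suc M)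
      ≈⟨ ⊛-congʳ (H (s ℕ.+ 2 ℕ.* suc M)) (≈-sym (poch-suc (c ℕ.+ s) M)) ⟩
    poch (c ℕ.+ s) (suc M) ⊛ H (s ℕ.+ 2 ℕ.* suc M)
      ∎
    where
    H = binomialSeries c
    u = one ⊖ mono s
    v = one ⊖ mono (c ℕ.+ s)
    exponent : s ℕ.+ 2 ℕ.+ 2 ℕ.* M ≡ s ℕ.+ 2 ℕ.* suc M
    exponent = trans (ℕ.+-assoc s 2 (2 ℕ.* M)) (cong (s ℕ.+_) (sym (ℕ.*-suc 2 M)))

  binomialSeries≈one : ∀ c s → N < s → binomialSeries c s ≈[ N ] one
  binomialSeries≈one c s N<s = ≈-trans
    (sumInf≈head (binomialTerm c s) N<s (λ m → q^∣-≤ (ℕ.m≤m*n s (suc m)) (q^∣binomialTerm c s (suc m))))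
    (binomialTerm-zero c s)

  q-binomial : ∀ c s → 1 ≤ s → binomialSeries c s ≈[ N ] pochInf (c ℕ.+ s) ÷ pochInf s
  q-binomial c s 1≤s = ÷-unique (pochInf-unit s 1≤s) (begin
    H s ⊛ pochInf s                       ≈⟨ ⊛-congˡ (H s) (pochInf≈poch s N<M) ⟩
    H s ⊛ poch s M                        ≈⟨ *-comm (H s) (poch s M) ⟩
    poch s M ⊛ H s                        ≈⟨ poch-⊛-binomialSeries c s M 1≤s ⟩
    poch (c ℕ.+ s) M ⊛ H (s ℕ.+ 2 ℕ.* M)  ≈⟨ ⊛-congˡ (poch (c ℕ.+ s) M) (binomialSeries≈one c _ N<s+2M) ⟩
    poch (c ℕ.+ s) M ⊛ one                ≈⟨ *-identityʳ (poch (c ℕ.+ s) M) ⟩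
    poch (c ℕ.+ s) M                      ≈⟨ ≈-sym (pochInf≈poch (c ℕ.+ s) N<M) ⟩
    pochInf (c ℕ.+ s)                     ∎)
    where
    H = binomialSeries c
    M = suc N
    N<M = ℕ.n<1+n N
    N<s+2M = ℕ.<-≤-trans N<M (ℕ.≤-trans (ℕ.m≤m+n M (M ℕ.+ 0)) (ℕ.m≤n+m _ s))

-- The identity for F_{k,1}

F-summand : ℕ → ℕ → FPS
F-summand k n = pochInf (2 ℕ.* n ℕ.+ 2) ⊛ pochInf (2 ℕ.* n ℕ.+ 2 ℕ.* k)
                ⊛ inv (pochInf (2 ℕ.* n ℕ.+ 1) ⊛ pochInf (2 ℕ.* n ℕ.+ 1)) ⊛ mono (2 ℕ.* n ℕ.+ 1)

G-summand : ℕ → ℕ → FPS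
G-summand k m = poch (2 ℕ.* k ∸ 1) m ⊛ mono (suc m) ⊛ inv (poch 1 (suc m))

ratio : ℕ → FPS
ratio n = pochInf (2 ℕ.* n ℕ.+ 2) ÷ pochInf (2 ℕ.* n ℕ.+ 1)

outerTerm : ℕ → ℕ → FPS
outerTerm k m = poch (2 ℕ.* k ∸ 1) m ÷ poch 2 m ⊛ mono (suc m)

module MainExponents where
  open ℕ-Solver.+-*-Solver

  even : ∀ n → 2 ℕ.+ 2 ℕ.* n ≡ 2 ℕ.* n ℕ.+ 2
  even = solve 1 (λ n → con 2 :+ con 2 :* n := con 2 :* n :+ con 2) refl

  odd : ∀ n → 1 ℕ.+ 2 ℕ.* n ≡ 2 ℕ.* n ℕ.+ 1
  odd = solve 1 (λ n → con 1 :+ con 2 :* n := con 2 :* n :+ con 1) refl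

  odd-suc : ∀ m → 1 ℕ.+ 2 ℕ.* suc m ≡ 1 ℕ.+ (2 ℕ.* m ℕ.+ 2)
  odd-suc = solve 1 (λ m → con 1 :+ con 2 :* (con 1 :+ m) := con 1 :+ (con 2 :* m :+ con 2)) refl

  exchange : ∀ n m → 2 ℕ.* n ℕ.+ 1 ℕ.+ (2 ℕ.* n ℕ.+ 1) ℕ.* m ≡ suc m ℕ.+ (2 ℕ.* m ℕ.+ 2) ℕ.* n
  exchange = solve 2 (λ n m → con 2 :* n :+ con 1 :+ (con 2 :* n :+ con 1) :* m
                           := con 1 :+ m :+ (con 2 :* m :+ con 2) :* n) refl

  -- 2k ∸ 1 is a truncated subtraction; this is where 1 ≤ k is used.
  shift : ∀ k → 1 ≤ k → ∀ n → 2 ℕ.* k ∸ 1 ℕ.+ (2 ℕ.* n ℕ.+ 1) ≡ 2 ℕ.* n ℕ.+ 2 ℕ.* k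
  shift (suc k) _ n = solve 2 (λ k n → k :+ (con 1 :+ (k :+ con 0)) :+ (con 2 :* n :+ con 1)
                                    := con 2 :* n :+ con 2 :* (con 1 :+ k)) refl k n

module _ {N : ℕ} where
  open SeriesReasoning N

  ratio-shift : ∀ n → ratio 0 ⊛ (poch 1 n ÷ poch 2 n) ≈[ N ] ratio n
  ratio-shift n = begin
    pochInf 2 ÷ pochInf 1 ⊛ (poch 1 n ÷ poch 2 n)
      ≈⟨ ÷-⊛-÷ (pochInf 2) (poch 1 n) (pochInf-unit 1 ℕ.≤-refl) (poch-unit 2 n (s≤s z≤n)) ⟩
    (pochInf 2 ⊛ poch 1 n) ÷ (pochInf 1 ⊛ poch 2 n)
      ≈⟨ ÷-cross (pochInf 2 ⊛ poch 1 n) A (Unit-⊛ (pochInf-unit 1 ℕ.≤-refl) (poch-unit 2 n (s≤s z≤n)))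
                 (pochInf-unit (2 ℕ.* n ℕ.+ 1) (ℕ.m≤n+m 1 _)) (begin
           pochInf 2 ⊛ poch 1 n ⊛ B
             ≈⟨ ⊛-congʳ B (⊛-congʳ (poch 1 n) (pochInf-split 2 n (MainExponents.even n))) ⟩
           poch 2 n ⊛ A ⊛ poch 1 n ⊛ B
             ≈⟨ solve 4 (λ p₂ A p₁ B → p₂ :* A :* p₁ :* B := A :* (p₁ :* B :* p₂)) ≈-refl (poch 2 n) A (poch 1 n) B ⟩
           A ⊛ (poch 1 n ⊛ B ⊛ poch 2 n)
             ≈⟨ ⊛-congˡ A (⊛-congʳ (poch 2 n) (≈-sym (pochInf-split 1 n (MainExponents.odd n)))) ⟩
           A ⊛ (pochInf 1 ⊛ poch 2 n)
             ∎) ⟩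
    A ÷ B
      ∎
    where
    A = pochInf (2 ℕ.* n ℕ.+ 2)
    B = pochInf (2 ℕ.* n ℕ.+ 1)

  ratio-zero-split : ∀ m →
    ratio 0 ⊛ (pochInf (1 ℕ.+ (2 ℕ.* m ℕ.+ 2)) ÷ pochInf (2 ℕ.* m ℕ.+ 2)) ≈[ N ] poch 2 m ÷ poch 1 (suc m)
  ratio-zero-split m = begin
    pochInf 2 ÷ pochInf 1 ⊛ (pochInf (1 ℕ.+ s) ÷ pochInf s)
      ≈⟨ ÷-⊛-÷ (pochInf 2) (pochInf (1 ℕ.+ s)) (pochInf-unit 1 ℕ.≤-refl) (pochInf-unit s 1≤s) ⟩
    (pochInf 2 ⊛ pochInf (1 ℕ.+ s)) ÷ (pochInf 1 ⊛ pochInf s)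
      ≈⟨ ÷-cross (pochInf 2 ⊛ pochInf (1 ℕ.+ s)) (poch 2 m) (Unit-⊛ (pochInf-unit 1 ℕ.≤-refl) (pochInf-unit s 1≤s))
                 (poch-unit 1 (suc m) ℕ.≤-refl) (begin
           pochInf 2 ⊛ pochInf (1 ℕ.+ s) ⊛ poch 1 (suc m)
             ≈⟨ ⊛-congʳ (poch 1 (suc m)) (⊛-congʳ (pochInf (1 ℕ.+ s)) (pochInf-split 2 m (MainExponents.even m))) ⟩
           poch 2 m ⊛ pochInf s ⊛ pochInf (1 ℕ.+ s) ⊛ poch 1 (suc m)
             ≈⟨ solve 4 (λ p₂ A B p₁ → p₂ :* A :* B :* p₁ := p₂ :* (p₁ :* B :* A))
                      ≈-refl (poch 2 m) (pochInf s) (pochInf (1 ℕ.+ s)) (poch 1 (suc m)) ⟩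
           poch 2 m ⊛ (poch 1 (suc m) ⊛ pochInf (1 ℕ.+ s) ⊛ pochInf s)
             ≈⟨ ⊛-congˡ (poch 2 m) (⊛-congʳ (pochInf s) (≈-sym (pochInf-split 1 (suc m) (MainExponents.odd-suc m)))) ⟩
           poch 2 m ⊛ (pochInf 1 ⊛ pochInf s)
             ∎) ⟩
    poch 2 m ÷ poch 1 (suc m)
      ∎
    where
    s = 2 ℕ.* m ℕ.+ 2
    1≤s = ℕ.≤-trans (s≤s z≤n) (ℕ.m≤n+m 2 (2 ℕ.* m))

  ratio-series : ∀ m →
    sumSeries (suc N) (λ n → mono ((2 ℕ.* m ℕ.+ 2) ℕ.* n) ⊛ ratio n) ≈[ N ] poch 2 m ÷ poch 1 (suc m)
  ratio-series m = begin
    sumSeries (suc N) (λ n → mono (s ℕ.* n) ⊛ ratio n)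
      ≈⟨ sumSeries-cong (suc N) (λ n _ → term n) ⟩
    sumSeries (suc N) (λ n → ratio 0 ⊛ binomialTerm 1 s n)
      ≈⟨ ≈-sym (⊛-sumSeries (ratio 0) (suc N) (binomialTerm 1 s)) ⟩
    ratio 0 ⊛ sumSeries (suc N) (binomialTerm 1 s)
      ≈⟨ ⊛-congˡ (ratio 0) (≈-sym (sumInf≈sumSeries (binomialTerm 1 s) ℕ.≤-refl (q^m∣binomialTerm 1 1≤s))) ⟩
    ratio 0 ⊛ binomialSeries 1 s
      ≈⟨ ⊛-congˡ (ratio 0) (q-binomial 1 s 1≤s) ⟩
    ratio 0 ⊛ (pochInf (1 ℕ.+ s) ÷ pochInf s)
      ≈⟨ ratio-zero-split m ⟩
    poch 2 m ÷ poch 1 (suc m)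
      ∎
    where
    s = 2 ℕ.* m ℕ.+ 2
    1≤s = ℕ.≤-trans (s≤s z≤n) (ℕ.m≤n+m 2 (2 ℕ.* m))
    term : ∀ n → mono (s ℕ.* n) ⊛ ratio n ≈[ N ] ratio 0 ⊛ binomialTerm 1 s n
    term n = begin
      mono (s ℕ.* n) ⊛ ratio n
        ≈⟨ ⊛-congˡ (mono (s ℕ.* n)) (≈-sym (ratio-shift n)) ⟩
      mono (s ℕ.* n) ⊛ (ratio 0 ⊛ (poch 1 n ÷ poch 2 n))
        ≈⟨ solve 3 (λ x r t → x :* (r :* t) := r :* (t :* x)) ≈-refl (mono (s ℕ.* n)) (ratio 0) (poch 1 n ÷ poch 2 n) ⟩
      ratio 0 ⊛ binomialTerm 1 s n
        ∎

  binomialTerm-exchange : ∀ k n m →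
    ratio n ⊛ mono (2 ℕ.* n ℕ.+ 1) ⊛ binomialTerm (2 ℕ.* k ∸ 1) (2 ℕ.* n ℕ.+ 1) m
      ≈[ N ] outerTerm k m ⊛ (mono ((2 ℕ.* m ℕ.+ 2) ℕ.* n) ⊛ ratio n)
  binomialTerm-exchange k n m = begin
    ratio n ⊛ z ⊛ (T ⊛ mono (s ℕ.* m))
      ≈⟨ solve 4 (λ r z T x → r :* z :* (T :* x) := T :* (z :* x) :* r) ≈-refl (ratio n) z T (mono (s ℕ.* m)) ⟩
    T ⊛ (z ⊛ mono (s ℕ.* m)) ⊛ ratio n
      ≈⟨ ⊛-congʳ (ratio n) (⊛-congˡ T (≈-trans (mono-⊛-mono s (s ℕ.* m) (MainExponents.exchange n m))
                                               (≈-sym (mono-⊛-mono (suc m) ((2 ℕ.* m ℕ.+ 2) ℕ.* n) refl)))) ⟩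
    T ⊛ (mono (suc m) ⊛ mono ((2 ℕ.* m ℕ.+ 2) ℕ.* n)) ⊛ ratio n
      ≈⟨ solve 4 (λ T a b r → T :* (a :* b) :* r := T :* a :* (b :* r))
               ≈-refl T (mono (suc m)) (mono ((2 ℕ.* m ℕ.+ 2) ℕ.* n)) (ratio n) ⟩
    outerTerm k m ⊛ (mono ((2 ℕ.* m ℕ.+ 2) ℕ.* n) ⊛ ratio n)
      ∎
    where
    s = 2 ℕ.* n ℕ.+ 1
    z = mono s
    T = poch (2 ℕ.* k ∸ 1) m ÷ poch 2 m

  F-summand-expansion : ∀ k → 1 ≤ k → ∀ n →
    F-summand k n ≈[ N ] sumSeries (suc N) (λ m → outerTerm k m ⊛ (mono ((2 ℕ.* m ℕ.+ 2) ℕ.* n) ⊛ ratio n))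
  F-summand-expansion k 1≤k n = begin
    (A ⊛ B) ÷ (P ⊛ P) ⊛ z
      ≈⟨ ⊛-congʳ z (≈-sym (÷-⊛-÷ A B uP uP)) ⟩
    ratio n ⊛ (B ÷ P) ⊛ z
      ≈⟨ ⊛-congʳ z (⊛-congˡ (ratio n) (≈-sym (≈-trans (q-binomial c s 1≤s) B÷P))) ⟩
    ratio n ⊛ binomialSeries c s ⊛ z
      ≈⟨ ⊛-congʳ z (⊛-congˡ (ratio n) (sumInf≈sumSeries (binomialTerm c s) ℕ.≤-refl (q^m∣binomialTerm c 1≤s))) ⟩
    ratio n ⊛ sumSeries (suc N) (binomialTerm c s) ⊛ z
      ≈⟨ solve 3 (λ r S z → r :* S :* z := r :* z :* S) ≈-refl (ratio n) (sumSeries (suc N) (binomialTerm c s)) z ⟩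
    ratio n ⊛ z ⊛ sumSeries (suc N) (binomialTerm c s)
      ≈⟨ ⊛-sumSeries (ratio n ⊛ z) (suc N) (binomialTerm c s) ⟩
    sumSeries (suc N) (λ m → ratio n ⊛ z ⊛ binomialTerm c s m)
      ≈⟨ sumSeries-cong (suc N) (λ m _ → binomialTerm-exchange k n m) ⟩
    sumSeries (suc N) (λ m → outerTerm k m ⊛ (mono ((2 ℕ.* m ℕ.+ 2) ℕ.* n) ⊛ ratio n))
      ∎
    where
    c = 2 ℕ.* k ∸ 1
    s = 2 ℕ.* n ℕ.+ 1
    1≤s = ℕ.m≤n+m 1 (2 ℕ.* n)
    A = pochInf (2 ℕ.* n ℕ.+ 2)
    B = pochInf (2 ℕ.* n ℕ.+ 2 ℕ.* k)
    P = pochInf s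
    z = mono s
    uP = pochInf-unit s 1≤s
    B÷P : pochInf (c ℕ.+ s) ÷ P ≈[ N ] B ÷ P
    B÷P = ≈-reflexive (cong (λ e → pochInf e ÷ P) (MainExponents.shift k 1≤k n))

  outerTerm-cancel : ∀ k m → outerTerm k m ⊛ (poch 2 m ÷ poch 1 (suc m)) ≈[ N ] G-summand k m
  outerTerm-cancel k m = begin
    p ÷ poch 2 m ⊛ mono (suc m) ⊛ (poch 2 m ÷ poch 1 (suc m))
      ≈⟨ solve 5 (λ p q⁻¹ z q r⁻¹ → p :* q⁻¹ :* z :* (q :* r⁻¹) := p :* z :* r⁻¹ :* (q :* q⁻¹))
               ≈-refl p (inv (poch 2 m)) (mono (suc m)) (poch 2 m) (inv (poch 1 (suc m))) ⟩
    G-summand k m ⊛ (poch 2 m ÷ poch 2 m)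
      ≈⟨ ⊛-congˡ (G-summand k m) (⊛-inverseʳ (poch-unit 2 m (s≤s z≤n))) ⟩
    G-summand k m ⊛ one
      ≈⟨ *-identityʳ (G-summand k m) ⟩
    G-summand k m
      ∎
    where p = poch (2 ℕ.* k ∸ 1) m

  F≈G : ∀ k → 1 ≤ k → F k ≈[ N ] G k
  F≈G k 1≤k = begin
    sumInf (F-summand k)
      ≈⟨ sumInf≈sumSeries (F-summand k) ℕ.≤-refl q^n∣F-summand ⟩
    sumSeries L (F-summand k)
      ≈⟨ sumSeries-cong L (λ n _ → F-summand-expansion k 1≤k n) ⟩
    sumSeries L (λ n → sumSeries L (λ m → X n m))
      ≈⟨ sumSeries-comm L L X ⟩
    sumSeries L (λ m → sumSeries L (λ n → X n m))
      ≈⟨ sumSeries-cong L (λ m _ → ≈-sym (⊛-sumSeries (outerTerm k m) L (Y m))) ⟩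
    sumSeries L (λ m → outerTerm k m ⊛ sumSeries L (Y m))
      ≈⟨ sumSeries-cong L (λ m _ → ≈-trans (⊛-congˡ (outerTerm k m) (ratio-series m)) (outerTerm-cancel k m)) ⟩
    sumSeries L (G-summand k)
      ≈⟨ ≈-sym (sumInf≈sumSeries (G-summand k) ℕ.≤-refl q^m∣G-summand) ⟩
    sumInf (G-summand k)
      ∎
    where
    L = suc N
    Y : ℕ → ℕ → FPS
    Y m n = mono ((2 ℕ.* m ℕ.+ 2) ℕ.* n) ⊛ ratio n
    X : ℕ → ℕ → FPS
    X n m = outerTerm k m ⊛ Y m n
    q^n∣F-summand : ∀ n → q^ n ∣ F-summand k n
    q^n∣F-summand n = q^∣-≤ (ℕ.≤-trans (ℕ.m≤n*m n 2) (ℕ.m≤m+n (2 ℕ.* n) 1)) (q^∣-⊛ʳ prefix (q^∣mono (2 ℕ.* n ℕ.+ 1)))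
      where
      prefix = pochInf (2 ℕ.* n ℕ.+ 2) ⊛ pochInf (2 ℕ.* n ℕ.+ 2 ℕ.* k)
               ⊛ inv (pochInf (2 ℕ.* n ℕ.+ 1) ⊛ pochInf (2 ℕ.* n ℕ.+ 1))
    q^m∣G-summand : ∀ m → q^ m ∣ G-summand k m
    q^m∣G-summand m = q^∣-⊛ˡ (inv (poch 1 (suc m)))
      (q^∣-⊛ʳ (poch (2 ℕ.* k ∸ 1) m) (q^∣-≤ (ℕ.n≤1+n m) (q^∣mono (suc m))))

lemma3p2 : (k : ℕ) → 1 ≤ k → (N : ℕ) → F k N ≡ G k N
lemma3p2 k 1≤k N = F≈G k 1≤k N ℕ.≤-refl
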